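{- Let $p$ be an odd prime and let $\mathcal{C}_{2p}=\operatorname{conv}(\pm e_1,\dots,\pm e_{p-1},\pm\mathbf{1})\subset\mathbb{R}^{p-1}$, where $\mathbf{1}=e_1+\cdots+e_{p-1}$; its vertex set is the set $A$ of these $2p$ vectors (the columns of $[\,I_{p-1}\ \ -\mathbf{1}\ \ -I_{p-1}\ \ \mathbf{1}\,]$). Let $1\le k\le\frac{p-1}{2}$. Then every $k$-element subset of $A$ that contains no pair of opposite vectors ($v$ and $-v$) is the vertex set of a $(k-1)$-dimensional face of $\mathcal{C}_{2p}$.
   Context: $\mathcal{C}_{2p}$ is the cyclotomic polytope of $\mathbb{Z}[\zeta_{2p}]$, i.e. $\mathcal{C}_2\otimes\mathcal{C}_p$ with $\mathcal{C}_2=\operatorname{conv}(1,-1)\subset\mathbb{R}$ and $\mathcal{C}_p=\operatorname{conv}(e_1,\dots,e_{p-1},-\mathbf{1})\subset\mathbb{R}^{p-1}$. -}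

module Defs where

open import Data.Bool using (Bool; true; false; not; if_then_else_)
open import Data.Nat using (ℕ; zero; suc; _∸_; _≡ᵇ_)
open import Data.Fin using (Fin; toℕ; zero; suc)
open import Data.Product using (_×_; _,_; proj₁; proj₂)
open import Data.Rational using (ℚ; 0ℚ; 1ℚ; -_; _+_; _*_)

Σℚ : ∀ {m} → (Fin m → ℚ) → ℚ
Σℚ {zero}  f = 0ℚ
Σℚ {suc m} f = f zero + Σℚ (λ i → f (suc i))

Pt : ℕ → Set
Pt p = Fin (p ∸ 1) → ℚ

-- u p j : for j = 0..p-2 the unit vector e_(j+1); for j = p-1 the vector -𝟏.
u : (p : ℕ) → Fin p → Pt p
u p j i = if toℕ j ≡ᵇ (p ∸ 1) then - 1ℚ
          else (if toℕ i ≡ᵇ toℕ j then 1ℚ else 0ℚ)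

-- Index set of the 2p vertices of C_2p: a sign (true = +, false = -) and an index j.
V : ℕ → Set
V p = Bool × Fin p

vert : (p : ℕ) → V p → Pt p
vert p (true  , j) = u p j
vert p (false , j) i = - u p j i

opp : ∀ {p} → V p → V p
opp (s , j) = (not s , j)

dot : (p : ℕ) → Pt p → Pt p → ℚ
dot p c x = Σℚ (λ i → c i * x i)

{-# OPTIONS --safe #-}
-- A linear functional c on ℚ^(p-1) is determined by its values on e_1, …, e_(p-1); its value on
-- -𝟏 is minus their sum, so any p values c·u_0, …, c·u_(p-1) with sum 0 are realised by some c.
-- For S = {s_m u_(j_m)} with distinct j_m, prescribe c·u_(j_m) = s_m (p - k) and c·u_j = -σ at the
-- other indices, where σ = Σ s_m; the total is 0. Then c·v = p - k on S, k - p on the opposites of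
-- S, and ±σ with |σ| ≤ k < p - k on the remaining vertices, so c exposes conv S as a face.
-- Prescribing instead c·v_m = (p - k) δ_mi shows that every coefficient of a vanishing linear
-- combination of S is zero.
module Submission where

open import Defs
open import Data.Nat using (ℕ; _≤_; _∸_; _/_)
open import Data.Nat.Primality using (Prime)
open import Data.Nat.Divisibility using (_∣_)
open import Data.Fin using (Fin)
open import Data.Vec using (Vec; lookup)
open import Data.Vec.Membership.Propositional using (_∈_; _∉_)
open import Data.Product using (Σ; _×_; _,_)
open import Data.Rational using (ℚ; 0ℚ; _<_; _*_)
open import Relation.Nullary using (¬_)
open import Relation.Binary.PropositionalEquality using (_≡_; _≢_)
open import Function.Definitions using (Injective)

open import Algebra.Bundles using (Ring)
open import Data.Bool using (Bool; true; false; not; if_then_else_)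
open import Data.Empty using (⊥-elim)
open import Data.Sum using (_⊎_; inj₁; inj₂)
open import Data.Fin using (zero; suc; toℕ; fromℕ; inject₁; punchIn)
import Data.Fin as Fin
open import Data.Fin.Properties using (toℕ-injective; toℕ-inject₁; toℕ-fromℕ; toℕ<n; punchInᵢ≢i; any?)
open import Data.Fin.Relation.Unary.Top using (view; ‵fromℕ; ‵inject₁)
import Data.Nat as ℕ
import Data.Nat.Properties as ℕ
open import Data.Nat.DivMod using (m/n*n≤m)
open import Data.Product using (proj₁; proj₂)
open import Data.Rational using (_+_; -_; _-_; 1ℚ; 1/_; NonZero; >-nonZero)
import Data.Rational as ℚ
open import Data.Rational.Properties
open import Data.Rational.Solver using (module +-*-Solver)
open import Data.Vec.Functional using (init)
open import Data.Vec.Membership.Propositional.Properties using (∈-lookup)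
import Data.Vec.Relation.Unary.Any as Any
open import Data.Vec.Relation.Unary.Any.Properties using (lookup-index)
open import Function using (_∘_)
open import Relation.Binary.PropositionalEquality using (refl; sym; trans; cong; cong₂; module ≡-Reasoning)
open import Relation.Nullary using (yes; no)
open import Relation.Nullary.Decidable using (dec-true; dec-false)

open import Algebra.Properties.Semiring.Sum (Ring.semiring +-*-ring)
  using (sum; sum-cong-≗; sum-replicate; sum-replicate-zero; sum-remove; sum-init-last; ∑-distrib-+; ∑-comm; *-distribˡ-sum)
import Algebra.Properties.Semiring.Mult (Ring.semiring +-*-ring) as Mult
open import Algebra.Properties.Ring +-*-ring using (-‿involutive; +-inverseʳ-unique; -1*x≈-x)

open +-*-Solver

Σℚ≡sum : ∀ {m} (f : Fin m → ℚ) → Σℚ f ≡ sum f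
Σℚ≡sum {ℕ.zero}  f = refl
Σℚ≡sum {ℕ.suc m} f = cong (f zero +_) (Σℚ≡sum (f ∘ suc))

sum-neg : ∀ {m} (f : Fin m → ℚ) → sum (λ i → - f i) ≡ - sum f
sum-neg {ℕ.zero}  f = refl
sum-neg {ℕ.suc m} f = trans (cong (- f zero +_) (sum-neg (f ∘ suc)))
                            (sym (neg-distrib-+ (f zero) (sum (f ∘ suc))))

sum-single : ∀ {m} (f : Fin m → ℚ) i → (∀ l → l ≢ i → f l ≡ 0ℚ) → sum f ≡ f i
sum-single {ℕ.suc m} f i f-vanishes = begin
  sum f                                  ≡⟨ sum-remove {i = i} f ⟩
  f i + sum (λ l → f (punchIn i l))      ≡⟨ cong (f i +_) (sum-cong-≗ {m} (λ l → f-vanishes (punchIn i l) (punchInᵢ≢i i l))) ⟩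
  f i + sum {m} (λ _ → 0ℚ)               ≡⟨ cong (f i +_) (sum-replicate-zero m) ⟩
  f i + 0ℚ                               ≡⟨ +-identityʳ (f i) ⟩
  f i                                    ∎
  where open ≡-Reasoning

δ : ∀ {m} → Fin m → Fin m → ℚ
δ i j = if toℕ i ℕ.≡ᵇ toℕ j then 1ℚ else 0ℚ

δ-diag : ∀ {m} (i : Fin m) → δ i i ≡ 1ℚ
δ-diag i rewrite dec-true (toℕ i ℕ.≟ toℕ i) refl = refl

δ-off : ∀ {m} {i j : Fin m} → i ≢ j → δ i j ≡ 0ℚ
δ-off {i = i} {j} i≢j rewrite dec-false (toℕ i ℕ.≟ toℕ j) (i≢j ∘ toℕ-injective) = refl

sum-*δ : ∀ {m} (f : Fin m → ℚ) j → sum (λ i → f i * δ i j) ≡ f j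
sum-*δ f j = begin
  sum (λ i → f i * δ i j) ≡⟨ sum-single _ j (λ i i≢j → trans (cong (f i *_) (δ-off i≢j)) (*-zeroʳ (f i))) ⟩
  f j * δ j j             ≡⟨ cong (f j *_) (δ-diag j) ⟩
  f j * 1ℚ                ≡⟨ *-identityʳ (f j) ⟩
  f j                     ∎
  where open ≡-Reasoning

ι : ℕ → ℚ
ι n = n Mult.× 1ℚ

ι-+ : ∀ m n → ι (m ℕ.+ n) ≡ ι m + ι n
ι-+ = Mult.×-homo-+ 1ℚ

sum-const : ∀ n x → sum {n} (λ _ → x) ≡ ι n * x
sum-const n x = begin
  sum {n} (λ _ → x) ≡⟨ sum-replicate n ⟩
  n Mult.× x        ≡⟨ Mult.×-congʳ n (*-identityˡ x) ⟨
  n Mult.× (1ℚ * x) ≡⟨ Mult.×-assoc-* n 1ℚ x ⟨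
  ι n * x           ∎
  where open ≡-Reasoning

0≤ι : ∀ n → 0ℚ ℚ.≤ ι n
0≤ι ℕ.zero    = ≤-refl
0≤ι (ℕ.suc n) = +-mono-≤ (<⇒≤ (positive⁻¹ 1ℚ)) (0≤ι n)

ι-mono-< : ∀ {m n} → m ℕ.< n → ι m < ι n
ι-mono-< {ℕ.zero}  {ℕ.suc n} _         = +-mono-<-≤ (positive⁻¹ 1ℚ) (0≤ι n)
ι-mono-< {ℕ.suc m} {ℕ.suc n} (ℕ.s≤s m<n) = +-monoʳ-< 1ℚ (ι-mono-< m<n)

signed : Bool → ℚ → ℚ
signed true  x = x
signed false x = - x

signed-zero : ∀ s → signed s 0ℚ ≡ 0ℚ
signed-zero true  = refl
signed-zero false = refl

signed-+ : ∀ s x y → signed s (x + y) ≡ signed s x + signed s y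
signed-+ true  x y = refl
signed-+ false x y = neg-distrib-+ x y

signed-*ˡ : ∀ s x y → signed s (x * y) ≡ signed s x * y
signed-*ˡ true  x y = refl
signed-*ˡ false x y = neg-distribˡ-* x y

signed≡*sign : ∀ s x → signed s x ≡ x * signed s 1ℚ
signed≡*sign true  x = sym (*-identityʳ x)
signed≡*sign false x = trans (cong -_ (sym (*-identityʳ x))) (neg-distribʳ-* x 1ℚ)

signed-neg : ∀ s x → signed s (- x) ≡ signed (not s) x
signed-neg true  x = refl
signed-neg false x = -‿involutive x

signed-involutive : ∀ s x → signed s (signed s x) ≡ x
signed-involutive true  x = refl
signed-involutive false x = -‿involutive x

signed-opposite : ∀ {s t} → t ≢ s → ∀ x → signed t (signed s x) ≡ - x
signed-opposite {true}  {true}  t≢s x = ⊥-elim (t≢s refl)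
signed-opposite {true}  {false} t≢s x = refl
signed-opposite {false} {true}  t≢s x = refl
signed-opposite {false} {false} t≢s x = ⊥-elim (t≢s refl)

sign≤1 : ∀ s t → signed t (signed s 1ℚ) ℚ.≤ 1ℚ
sign≤1 s t with s | t
... | true  | true  = ≤-refl
... | true  | false = <⇒≤ (neg<pos (- 1ℚ) 1ℚ)
... | false | true  = <⇒≤ (neg<pos (- 1ℚ) 1ℚ)
... | false | false = ≤-refl

sum-signs≤ : ∀ {k} (s : Fin k → Bool) t → signed t (sum (λ m → signed (s m) 1ℚ)) ℚ.≤ ι k
sum-signs≤ {ℕ.zero}  s t = ≤-reflexive (signed-zero t)
sum-signs≤ {ℕ.suc k} s t = begin
  signed t (signed (s zero) 1ℚ + σ)            ≡⟨ signed-+ t _ σ ⟩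
  signed t (signed (s zero) 1ℚ) + signed t σ   ≤⟨ +-mono-≤ (sign≤1 (s zero) t) (sum-signs≤ (s ∘ suc) t) ⟩
  1ℚ + ι k                                     ∎
  where
  open ≤-Reasoning
  σ : ℚ
  σ = sum (λ m → signed (s (suc m)) 1ℚ)

dot≡sum : ∀ p (c x : Pt p) → dot p c x ≡ sum (λ i → c i * x i)
dot≡sum p c x = Σℚ≡sum (λ i → c i * x i)

dot-vert : ∀ p (c : Pt p) s j → dot p c (vert p (s , j)) ≡ signed s (dot p c (u p j))
dot-vert p c true  j = refl
dot-vert p c false j = begin
  dot p c (vert p (false , j))      ≡⟨ dot≡sum p c _ ⟩
  sum (λ i → c i * - u p j i)       ≡⟨ sum-cong-≗ {p ∸ 1} (λ i → sym (neg-distribʳ-* (c i) (u p j i))) ⟩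
  sum (λ i → - (c i * u p j i))     ≡⟨ sum-neg (λ i → c i * u p j i) ⟩
  - sum (λ i → c i * u p j i)       ≡⟨ cong -_ (dot≡sum p c (u p j)) ⟨
  - dot p c (u p j)                 ∎
  where open ≡-Reasoning

dot-combination : ∀ p (c : Pt p) {k} (a : Fin k → ℚ) (x : Fin k → Pt p) →
  sum (λ m → a m * dot p c (x m)) ≡ sum (λ t → c t * sum (λ m → a m * x m t))
dot-combination p c {k} a x = begin
  sum (λ m → a m * dot p c (x m))                   ≡⟨ sum-cong-≗ {k} (λ m → cong (a m *_) (dot≡sum p c (x m))) ⟩
  sum (λ m → a m * sum (λ t → c t * x m t))         ≡⟨ sum-cong-≗ {k} (λ m → *-distribˡ-sum (a m) (λ t → c t * x m t)) ⟩
  sum (λ m → sum (λ t → a m * (c t * x m t)))       ≡⟨ ∑-comm (λ m t → a m * (c t * x m t)) ⟩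
  sum (λ t → sum (λ m → a m * (c t * x m t)))       ≡⟨ sum-cong-≗ {p ∸ 1} (λ t → sum-cong-≗ {k} (λ m → swap (a m) (c t) (x m t))) ⟩
  sum (λ t → sum (λ m → c t * (a m * x m t)))       ≡⟨ sum-cong-≗ {p ∸ 1} (λ t → *-distribˡ-sum (c t) (λ m → a m * x m t)) ⟨
  sum (λ t → c t * sum (λ m → a m * x m t))         ∎
  where
  open ≡-Reasoning
  swap : ∀ a c x → a * (c * x) ≡ c * (a * x)
  swap = solve 3 (λ a c x → a :* (c :* x) := c :* (a :* x)) refl

u-fromℕ : ∀ n i → u (ℕ.suc n) (fromℕ n) i ≡ - 1ℚ
u-fromℕ n i rewrite toℕ-fromℕ n | dec-true (n ℕ.≟ n) refl = refl

u-inject₁ : ∀ {n} (j : Fin n) i → u (ℕ.suc n) (inject₁ j) i ≡ δ i j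
u-inject₁ {n} j i rewrite toℕ-inject₁ j | dec-false (toℕ j ℕ.≟ n) (ℕ.<⇒≢ (toℕ<n j)) = refl

dot-init-u : ∀ n (f : Fin (ℕ.suc n) → ℚ) → sum f ≡ 0ℚ →
  ∀ j → dot (ℕ.suc n) (init f) (u (ℕ.suc n) j) ≡ f j
dot-init-u n f Σf≡0 j with view j
... | ‵fromℕ = begin
  dot (ℕ.suc n) (init f) (u (ℕ.suc n) (fromℕ n))     ≡⟨ dot≡sum (ℕ.suc n) (init f) _ ⟩
  sum (λ i → init f i * u (ℕ.suc n) (fromℕ n) i)     ≡⟨ sum-cong-≗ {n} (λ i → cong (init f i *_) (u-fromℕ n i)) ⟩
  sum (λ i → init f i * - 1ℚ)                        ≡⟨ sum-cong-≗ {n} (λ i → trans (*-comm (init f i) (- 1ℚ)) (-1*x≈-x (init f i))) ⟩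
  sum (λ i → - init f i)                             ≡⟨ sum-neg (init f) ⟩
  - sum (init f)                                     ≡⟨ +-inverseʳ-unique _ _ (trans (sym (sum-init-last f)) Σf≡0) ⟨
  f (fromℕ n)                                        ∎
  where open ≡-Reasoning
... | ‵inject₁ j′ = begin
  dot (ℕ.suc n) (init f) (u (ℕ.suc n) (inject₁ j′))  ≡⟨ dot≡sum (ℕ.suc n) (init f) _ ⟩
  sum (λ i → init f i * u (ℕ.suc n) (inject₁ j′) i)  ≡⟨ sum-cong-≗ {n} (λ i → cong (init f i *_) (u-inject₁ j′ i)) ⟩
  sum (λ i → init f i * δ i j′)                      ≡⟨ sum-*δ (init f) j′ ⟩
  f (inject₁ j′)                                     ∎
  where open ≡-Reasoning

dot-init-vert : ∀ n (f : Fin (ℕ.suc n) → ℚ) → sum f ≡ 0ℚ →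
  ∀ s j → dot (ℕ.suc n) (init f) (vert (ℕ.suc n) (s , j)) ≡ signed s (f j)
dot-init-vert n f Σf≡0 s j =
  trans (dot-vert (ℕ.suc n) (init f) s j) (cong (signed s) (dot-init-u n f Σf≡0 j))

module _ {n k} (j : Fin k → Fin n) where

  extend : ℚ → (Fin k → ℚ) → Fin n → ℚ
  extend α y l = α + sum (λ m → (y m - α) * δ l (j m))

  extend-at : Injective _≡_ _≡_ j → ∀ α y m → extend α y (j m) ≡ y m
  extend-at j-injective α y m = begin
    α + sum (λ m′ → (y m′ - α) * δ (j m) (j m′)) ≡⟨ cong (α +_) (sum-single _ m vanish) ⟩
    α + (y m - α) * δ (j m) (j m)                ≡⟨ cong (λ d → α + (y m - α) * d) (δ-diag (j m)) ⟩
    α + (y m - α) * 1ℚ                           ≡⟨ solve 2 (λ α y → α :+ (y :- α) :* con 1ℚ := y) refl α (y m) ⟩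
    y m                                          ∎
    where
    open ≡-Reasoning
    vanish : ∀ m′ → m′ ≢ m → (y m′ - α) * δ (j m) (j m′) ≡ 0ℚ
    vanish m′ m′≢m = trans (cong ((y m′ - α) *_) (δ-off (m′≢m ∘ sym ∘ j-injective))) (*-zeroʳ (y m′ - α))

  extend-outside : ∀ α y l → (∀ m → j m ≢ l) → extend α y l ≡ α
  extend-outside α y l l∉j = begin
    α + sum (λ m → (y m - α) * δ l (j m)) ≡⟨ cong (α +_) (sum-cong-≗ {k} vanish) ⟩
    α + sum {k} (λ _ → 0ℚ)                ≡⟨ cong (α +_) (sum-replicate-zero k) ⟩
    α + 0ℚ                                ≡⟨ +-identityʳ α ⟩
    α                                     ∎
    where
    open ≡-Reasoning
    vanish : ∀ m → (y m - α) * δ l (j m) ≡ 0ℚ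
    vanish m = trans (cong ((y m - α) *_) (δ-off (l∉j m ∘ sym))) (*-zeroʳ (y m - α))

  sum-extend : k ≤ n → ∀ α y → sum (extend α y) ≡ ι (n ∸ k) * α + sum y
  sum-extend k≤n α y = begin
    sum (extend α y)                                            ≡⟨ ∑-distrib-+ {n} (λ _ → α) spikes ⟩
    sum {n} (λ _ → α) + sum spikes                              ≡⟨ cong₂ _+_ (sum-const n α) (∑-comm {n} {k} (λ l m → (y m - α) * δ l (j m))) ⟩
    ι n * α + sum (λ m → sum (λ l → (y m - α) * δ l (j m)))     ≡⟨ cong (ι n * α +_) (sum-cong-≗ {k} (λ m → sum-*δ {n} (λ _ → y m - α) (j m))) ⟩
    ι n * α + sum (λ m → y m - α)                               ≡⟨ cong (ι n * α +_) (∑-distrib-+ {k} y (λ _ → - α)) ⟩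
    ι n * α + (sum y + sum {k} (λ _ → - α))                     ≡⟨ cong (λ z → ι n * α + (sum y + z)) (sum-const k (- α)) ⟩
    ι n * α + (sum y + ι k * - α)                               ≡⟨ cong (λ z → z * α + (sum y + ι k * - α)) ι-split ⟩
    (ι (n ∸ k) + ι k) * α + (sum y + ι k * - α)                 ≡⟨ solve 4 (λ r k α Σy → (r :+ k) :* α :+ (Σy :+ k :* (:- α)) := r :* α :+ Σy)
                                                                          refl (ι (n ∸ k)) (ι k) α (sum y) ⟩
    ι (n ∸ k) * α + sum y                                       ∎
    where
    open ≡-Reasoning
    spikes : Fin n → ℚ
    spikes l = sum (λ m → (y m - α) * δ l (j m))
    ι-split : ι n ≡ ι (n ∸ k) + ι k
    ι-split = trans (cong ι (sym (ℕ.m∸n+n≡m k≤n))) (ι-+ (n ∸ k) k)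

module Prescribed {n k} (sign : Fin k → Bool) (index : Fin k → Fin (ℕ.suc n))
  (index-injective : Injective _≡_ _≡_ index) (k≤p : k ≤ ℕ.suc n)
  (y : Fin k → ℚ) (x : ℚ) (balanced : sum (λ m → signed (sign m) (y m)) ≡ ι (ℕ.suc n ∸ k) * x) where

  private
    y± : Fin k → ℚ
    y± m = signed (sign m) (y m)

    f : Fin (ℕ.suc n) → ℚ
    f = extend index (- x) y±

    sum-f≡0 : sum f ≡ 0ℚ
    sum-f≡0 = begin
      sum f                                       ≡⟨ sum-extend index k≤p (- x) y± ⟩
      ι (ℕ.suc n ∸ k) * - x + sum y±              ≡⟨ cong (ι (ℕ.suc n ∸ k) * - x +_) balanced ⟩
      ι (ℕ.suc n ∸ k) * - x + ι (ℕ.suc n ∸ k) * x ≡⟨ solve 2 (λ r x → r :* (:- x) :+ r :* x := con 0ℚ) refl (ι (ℕ.suc n ∸ k)) x ⟩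
      0ℚ                                          ∎
      where open ≡-Reasoning

  functional : Pt (ℕ.suc n)
  functional = init f

  dot-functional-index : ∀ t m →
    dot (ℕ.suc n) functional (vert (ℕ.suc n) (t , index m)) ≡ signed t (signed (sign m) (y m))
  dot-functional-index t m = trans (dot-init-vert n f sum-f≡0 t (index m))
                                   (cong (signed t) (extend-at index index-injective (- x) y± m))

  dot-functional-outside : ∀ t l → (∀ m → index m ≢ l) →
    dot (ℕ.suc n) functional (vert (ℕ.suc n) (t , l)) ≡ signed t (- x)
  dot-functional-outside t l l∉index = trans (dot-init-vert n f sum-f≡0 t l)
                                             (cong (signed t) (extend-outside index (- x) y± l l∉index))

p*q≡0⇒p≡0 : ∀ p q .{{_ : NonZero q}} → p * q ≡ 0ℚ → p ≡ 0ℚ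
p*q≡0⇒p≡0 p q pq≡0 = begin
  p                ≡⟨ *-identityʳ p ⟨
  p * 1ℚ           ≡⟨ cong (p *_) (*-inverseʳ q) ⟨
  p * (q * 1/ q)   ≡⟨ *-assoc p q (1/ q) ⟨
  p * q * 1/ q     ≡⟨ cong (_* 1/ q) pq≡0 ⟩
  0ℚ * 1/ q        ≡⟨ *-zeroˡ (1/ q) ⟩
  0ℚ               ∎
  where open ≡-Reasoning

equal-or-opposite : ∀ {p} (v w : V p) → proj₂ v ≡ proj₂ w → v ≡ w ⊎ w ≡ opp v
equal-or-opposite (true  , j) (true  , .j) refl = inj₁ refl
equal-or-opposite (true  , j) (false , .j) refl = inj₂ refl
equal-or-opposite (false , j) (true  , .j) refl = inj₂ refl
equal-or-opposite (false , j) (false , .j) refl = inj₁ refl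

IsFace : ∀ {p k} → Vec (V p) k → Set
IsFace {p} S = Σ (Pt p) λ c → Σ ℚ λ b →
  (∀ v → v ∈ S → dot p c (vert p v) ≡ b) × (∀ v → v ∉ S → dot p c (vert p v) < b)

LinearlyIndependent : ∀ {p k} → Vec (V p) k → Set
LinearlyIndependent {p} {k} S = ∀ (λs : Fin k → ℚ) →
  (∀ t → Σℚ (λ m → λs m * vert p (lookup S m) t) ≡ 0ℚ) → ∀ m → λs m ≡ 0ℚ

module OppositeFree {n k} (S : Vec (V (ℕ.suc n)) k)
  (S-injective : Injective _≡_ _≡_ (lookup S))
  (S-no-opposite : ∀ i j → lookup S j ≢ opp (lookup S i))
  (2k<p : k ℕ.+ k ℕ.< ℕ.suc n) where

  private
    p : ℕ
    p = ℕ.suc n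

    sign : Fin k → Bool
    sign m = proj₁ (lookup S m)

    index : Fin k → Fin p
    index m = proj₂ (lookup S m)

    index-injective : Injective _≡_ _≡_ index
    index-injective {m} {m′} eq with equal-or-opposite (lookup S m) (lookup S m′) eq
    ... | inj₁ same     = S-injective same
    ... | inj₂ opposite = ⊥-elim (S-no-opposite m m′ opposite)

    k≤p : k ≤ p
    k≤p = ℕ.<⇒≤ (ℕ.m+n≤o⇒m≤o (ℕ.suc k) 2k<p)

    B : ℚ
    B = ι (p ∸ k)

    ιk<B : ι k < B
    ιk<B = ι-mono-< (ℕ.m+n≤o⇒m≤o∸n (ℕ.suc k) 2k<p)

    0<B : 0ℚ < B
    0<B = ≤-<-trans (0≤ι k) ιk<B

    σ : ℚ
    σ = sum (λ m → signed (sign m) 1ℚ)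

    sum-signed-B : sum (λ m → signed (sign m) B) ≡ B * σ
    sum-signed-B = trans (sum-cong-≗ {k} (λ m → signed≡*sign (sign m) B))
                         (sym (*-distribˡ-sum B (λ m → signed (sign m) 1ℚ)))

    sum-signed-Bδ : ∀ i → sum (λ m → signed (sign m) (B * δ m i)) ≡ B * signed (sign i) 1ℚ
    sum-signed-Bδ i = begin
      sum (λ m → signed (sign m) (B * δ m i))  ≡⟨ sum-cong-≗ {k} (λ m → signed-*ˡ (sign m) B (δ m i)) ⟩
      sum (λ m → signed (sign m) B * δ m i)    ≡⟨ sum-*δ (λ m → signed (sign m) B) i ⟩
      signed (sign i) B                        ≡⟨ signed≡*sign (sign i) B ⟩
      B * signed (sign i) 1ℚ                   ∎
      where open ≡-Reasoning

  isFace : IsFace S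
  isFace = functional , B , on-S , off-S
    where
    open Prescribed sign index index-injective k≤p (λ _ → B) σ sum-signed-B

    on-S : ∀ v → v ∈ S → dot p functional (vert p v) ≡ B
    on-S v v∈S = begin
      dot p functional (vert p v)             ≡⟨ cong (dot p functional ∘ vert p) (lookup-index v∈S) ⟩
      dot p functional (vert p (lookup S m))  ≡⟨ dot-functional-index (sign m) m ⟩
      signed (sign m) (signed (sign m) B)     ≡⟨ signed-involutive (sign m) B ⟩
      B                                       ∎
      where
      open ≡-Reasoning
      m : Fin k
      m = Any.index v∈S

    off-S : ∀ v → v ∉ S → dot p functional (vert p v) < B
    off-S (t , l) v∉S with any? (λ m → index m Fin.≟ l)
    ... | yes (m , refl) = begin-strict
      dot p functional (vert p (t , index m))  ≡⟨ dot-functional-index t m ⟩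
      signed t (signed (sign m) B)             ≡⟨ signed-opposite t≢sign B ⟩
      - B                                      <⟨ neg-antimono-< 0<B ⟩
      0ℚ                                       <⟨ 0<B ⟩
      B                                        ∎
      where
      open ≤-Reasoning
      t≢sign : t ≢ sign m
      t≢sign refl = v∉S (∈-lookup m S)
    ... | no l∉index = begin-strict
      dot p functional (vert p (t , l))        ≡⟨ dot-functional-outside t l (λ m eq → l∉index (m , eq)) ⟩
      signed t (- σ)                           ≡⟨ signed-neg t σ ⟩
      signed (not t) σ                         ≤⟨ sum-signs≤ sign (not t) ⟩
      ι k                                      <⟨ ιk<B ⟩
      B                                        ∎
      where open ≤-Reasoning

  linearlyIndependent : LinearlyIndependent S
  linearlyIndependent λs combination≡0 i = p*q≡0⇒p≡0 (λs i) B {{>-nonZero 0<B}} λsᵢ*B≡0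
    where
    open Prescribed sign index index-injective k≤p (λ m → B * δ m i) (signed (sign i) 1ℚ) (sum-signed-Bδ i)

    at-S : ∀ m → dot p functional (vert p (lookup S m)) ≡ B * δ m i
    at-S m = trans (dot-functional-index (sign m) m) (signed-involutive (sign m) (B * δ m i))

    vanishes : ∀ t → sum (λ m → λs m * vert p (lookup S m) t) ≡ 0ℚ
    vanishes t = trans (sym (Σℚ≡sum (λ m → λs m * vert p (lookup S m) t))) (combination≡0 t)

    λsᵢ*B≡0 : λs i * B ≡ 0ℚ
    λsᵢ*B≡0 = begin
      λs i * B                                                             ≡⟨ sum-*δ (λ m → λs m * B) i ⟨
      sum (λ m → λs m * B * δ m i)                                         ≡⟨ sum-cong-≗ {k} (λ m → trans (*-assoc (λs m) B (δ m i)) (cong (λs m *_) (sym (at-S m)))) ⟩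
      sum (λ m → λs m * dot p functional (vert p (lookup S m)))            ≡⟨ dot-combination p functional λs (λ m → vert p (lookup S m)) ⟩
      sum (λ t → functional t * sum (λ m → λs m * vert p (lookup S m) t))  ≡⟨ sum-cong-≗ {n} (λ t → trans (cong (functional t *_) (vanishes t)) (*-zeroʳ (functional t))) ⟩
      sum {n} (λ _ → 0ℚ)                                                   ≡⟨ sum-replicate-zero n ⟩
      0ℚ                                                                   ∎
      where open ≡-Reasoning

k≤n/2⇒k+k≤n : ∀ {k n} → k ≤ n / 2 → k ℕ.+ k ≤ n
k≤n/2⇒k+k≤n {k} {n} k≤n/2 = begin
  k ℕ.+ k      ≡⟨ cong (k ℕ.+_) (ℕ.+-identityʳ k) ⟨
  2 ℕ.* k      ≡⟨ ℕ.*-comm 2 k ⟩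
  k ℕ.* 2      ≤⟨ ℕ.*-monoˡ-≤ 2 k≤n/2 ⟩
  n / 2 ℕ.* 2  ≤⟨ m/n*n≤m n 2 ⟩
  n            ∎
  where open ℕ.≤-Reasoning

proposition5p1 : (p : ℕ) → Prime p → ¬ (2 ∣ p) →
    (k : ℕ) → 1 ≤ k → k ≤ (p ∸ 1) / 2 →
    (S : Vec (V p) k) →
    Injective _≡_ _≡_ (lookup S) →
    (∀ (i j : Fin k) → lookup S j ≢ opp (lookup S i)) →
    -- S is the vertex set of a face: a supporting hyperplane c·x = b contains exactly the vertices in S
    Σ (Pt p) (λ c → Σ ℚ (λ b →
      (∀ (v : V p) → v ∈ S → dot p c (vert p v) ≡ b) ×
      (∀ (v : V p) → v ∉ S → dot p c (vert p v) < b)))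
    -- and that face conv(S) has dimension k - 1: the points of S are affinely independent
    × (∀ (λs : Fin k → ℚ) → Σℚ λs ≡ 0ℚ →
         (∀ (t : Fin (p ∸ 1)) → Σℚ (λ i → λs i * vert p (lookup S i) t) ≡ 0ℚ) →
         ∀ (i : Fin k) → λs i ≡ 0ℚ)
proposition5p1 ℕ.zero    _ _ ℕ.zero    ()  _ _ _ _
proposition5p1 ℕ.zero    _ _ (ℕ.suc k) _   () _ _ _
proposition5p1 (ℕ.suc n) _ _ k         _   k≤n/2 S S-injective S-no-opposite =
  isFace , λ λs _ → linearlyIndependent λs
  where open OppositeFree S S-injective S-no-opposite (ℕ.s≤s (k≤n/2⇒k+k≤n k≤n/2))
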